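{- Let $G=(V,E)$ be a finite simple bipartite graph with bipartition $V_1,V_2$, and let $G'=(V',E')$ be obtained from $G$ by adding a new vertex $v_1$ adjacent to every vertex of $V_1$, and a new vertex $v_0$ adjacent only to $v_1$; let $n=|V'|$. Consider any execution of Algorithm ComputeAssignment on $(G',v_0)$ (a priori possibly infinite). Then for every $v\in V'$, $|S_v|\le 2n$.
   Context: For a sequence $P$ of vertices, $V(P)$ is its set of entries; the length of $P=p_0\ldots p_k$ is $k$ (the empty sequence has length $-1$). Algorithm ComputeAssignment$(G',v_0)$: initialize $\sigma(u)=\perp$ and $\tau(u)=\perp$ for all $u\in V'$ ($\perp$ a symbol not in $V'$), $R=\{v_0,v_1\}$, $P=v_0v_1$. While $P$ has length $\ge 1$: write $P=p_0p_1\ldots p_k$ and let $Z=\{u\in V'\setminus V(P): up_k\in E',\ \sigma(u)=\perp\}$. If $Z=\emptyset$ (deletion branch): set $\sigma(p_{k-1})\leftarrow p_k$, $\sigma(p_k)\leftarrow\perp$, $\tau(p_k)\leftarrow p_{k-1}$, $\tau(p_{k-1})\leftarrow\perp$, and remove $p_k,p_{k-1}$ from the end of $P$. Otherwise (introduction branch): choose (arbitrarily) $z\in Z$, let $w=\tau(z)$, append $z$ to $P$, add $z$ to $R$, and if $w\neq\perp$ also append $w$ to $P$. When the loop ends, return $(R,\sigma)$. Iterations of the while loop are called steps and numbered $1,2,\ldots$. For a pair $p=(x,y)$ with $x,y\in V'\cup\{\perp\}$, $p$ contains $v$ if $v\in\{x,y\}$. A step is a deletion of $(x,y)$ if it executes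 the deletion branch with $p_{k-1}=x$ and $p_k=y$; it is an introduction of $(x,y)$ if it executes the introduction branch with $z=x$ and $w=y$. For $v\in V'$, $S_v$ is the set of steps that are a deletion or an introduction of a pair containing $v$. -}

module Defs where

open import Data.Nat using (ℕ; zero; suc; _+_; _*_; _≤_)
open import Data.Fin using (Fin; zero; suc; _≟_)
open import Data.Bool using (Bool; true; false; if_then_else_)
open import Data.Maybe using (Maybe; just; nothing)
open import Data.List using (List; []; _∷_; _++_; length)
open import Data.List.Membership.Propositional using (_∈_; _∉_)
open import Data.List.Relation.Unary.All using (All)
open import Data.List.Relation.Unary.Unique.Propositional using (Unique)
open import Data.Product using (_×_; Σ; _,_)
open import Data.Sum using (_⊎_)
open import Data.Empty using (⊥)
open import Relation.Nullary using (¬_; does)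
open import Relation.Binary.PropositionalEquality using (_≡_; _≢_)

-- A finite simple bipartite graph G = (V,E) with V = Fin m.
-- Edges: adj u v ≡ true.  The bipartition is given by `side`:
-- V₁ = {u | side u ≡ true}, V₂ = {u | side u ≡ false}.

record BipGraph : Set where
  field
    m     : ℕ
    adj   : Fin m → Fin m → Bool
    sym   : ∀ u v → adj u v ≡ adj v u
    irrefl : ∀ u → adj u u ≡ false
    side  : Fin m → Bool
    bip   : ∀ u v → adj u v ≡ true → side u ≢ side v

-- The augmented graph G' = (V',E') with V' = Fin (2 + m):
--   zero           = v₀   (adjacent only to v₁)
--   suc zero       = v₁   (adjacent to v₀ and to every vertex of V₁)
--   suc (suc i)    = the original vertex i of G

module Aug (G : BipGraph) where
  open BipGraph G

  V' : Set
  V' = Fin (2 + m)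

  n : ℕ
  n = 2 + m

  v₀ v₁ : V'
  v₀ = zero
  v₁ = suc zero

  adj' : V' → V' → Bool
  adj' zero zero = false
  adj' zero (suc zero) = true
  adj' zero (suc (suc _)) = false
  adj' (suc zero) zero = true
  adj' (suc zero) (suc zero) = false
  adj' (suc zero) (suc (suc j)) = side j
  adj' (suc (suc i)) zero = false
  adj' (suc (suc i)) (suc zero) = side i
  adj' (suc (suc i)) (suc (suc j)) = adj i j

  E' : V' → V' → Set
  E' u v = adj' u v ≡ true

  -- States of ComputeAssignment.  `nothing` plays the role of ⊥.
  -- P = p₀ p₁ … p_k is stored as a list in this order.

  record State : Set where
    constructor st
    field
      σ τ : V' → Maybe V'
      R   : List V'
      P   : List V'

  upd : (V' → Maybe V') → V' → Maybe V' → V' → Maybe V'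
  upd f a b u = if does (u ≟ a) then b else f u

  initial : State
  initial = st (λ _ → nothing) (λ _ → nothing) (v₀ ∷ v₁ ∷ []) (v₀ ∷ v₁ ∷ [])

  data Label : Set where
    del   : V' → V' → Label
    intro : V' → Maybe V' → Label

  Contains : V' → Label → Set
  Contains v (del x y)   = v ≡ x ⊎ v ≡ y
  Contains v (intro z w) = v ≡ z ⊎ w ≡ just v

  InZ : (V' → Maybe V') → List V' → V' → V' → Set
  InZ σ P p u = u ∉ P × E' u p × σ u ≡ nothing

  appendMaybe : List V' → Maybe V' → List V'
  appendMaybe P nothing  = P
  appendMaybe P (just w) = P ++ w ∷ []

  -- One iteration of the while loop (P has length ≥ 1, i.e. ≥ 2 entries).
  data Step : State → Label → State → Set where
    deletion : ∀ {σ τ R} (Q : List V') (x y : V') →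
      (∀ u → ¬ InZ σ (Q ++ x ∷ y ∷ []) y u) →
      Step (st σ τ R (Q ++ x ∷ y ∷ []))
           (del x y)
           (st (upd (upd σ x (just y)) y nothing)
               (upd (upd τ y (just x)) x nothing)
               R Q)
    introduction : ∀ {σ τ R} (Q : List V') (x y z : V') →
      InZ σ (Q ++ x ∷ y ∷ []) y z →
      Step (st σ τ R (Q ++ x ∷ y ∷ []))
           (intro z (τ z))
           (st σ τ (z ∷ R) (appendMaybe ((Q ++ x ∷ y ∷ []) ++ z ∷ []) (τ z)))

  -- loop condition: P has length ≥ 1 (at least two entries)
  Active : State → Set
  Active s = 2 ≤ length (State.P s)

  -- A (possibly infinite) execution of ComputeAssignment(G', v₀).
  -- state i is the state before step i+1; label i describes step i+1.
  -- Once the loop has terminated, the state is frozen (labels meaningless).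
  record Execution : Set where
    field
      state : ℕ → State
      label : ℕ → Label
      start : state 0 ≡ initial
      run   : ∀ i → (Active (state i) × Step (state i) (label i) (state (suc i)))
                    ⊎ (¬ Active (state i) × state (suc i) ≡ state i)

  -- step i+1 belongs to S_v
  InS : Execution → V' → ℕ → Set
  InS ex v i = Active (Execution.state ex i) × Contains v (Execution.label ex i)

-- Let T be the number of vertices that lie on the path P or have σ or τ defined.  T never
-- decreases, is at most n, and strictly grows at every introduction with τ z = ⊥.  If a step
-- involves v while v is on P, it is the deletion of a pair (x, y) containing v; afterwards
-- x, y ∉ P, σ x = y and σ y = ⊥, and this persists while T stays put.  Meanwhile no step
-- involves x or y: the vertex z introduced has σ z = ⊥, so z ≠ x; since P alternates between
-- the two colour classes and |P| has the same parity as right after the deletion, the end of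
-- P has the colour of y, so z, adjacent to it, is not y; and its partner w = τ z has
-- σ w = z, so w ∉ {x, y}.  Hence T grows between such a step of S_v and any later one, so
-- 2T + [v ∈ P] strictly increases along S_v.  It takes values in [2, 2n + 1], which gives
-- |S_v| ≤ 2n.

module Submission where

open import Defs
open import Data.Nat using (ℕ; zero; suc; _+_; _*_; _∸_; _≤_; _<_; _≤′_; ≤′-refl; ≤′-step; z≤n; s≤s; _<?_)
open import Data.Nat.Properties
  using (≤-refl; ≤-reflexive; ≤-antisym; ≤-trans; ≤-pred; <⇒≤; <⇒≢; <⇒≱; ≮⇒≥; ≤∧≢⇒<; <-cmp;
         m≤n⇒m≤1+n; m<n⇒m<1+n; n≤1+n; n<1+n; ≤⇒≤′; ≤′-trans; +-suc; +-identityʳ; +-comm;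
         *-suc; *-monoʳ-≤; *-monoʳ-<; ∸-monoˡ-<; module ≤-Reasoning)
open import Data.Fin using (zero; suc; _≟_)
open import Data.Bool using (Bool; true; false; not)
open import Data.Bool.Properties using (not-injective; not-¬; ¬-not)
open import Data.Maybe using (Maybe; just; nothing)
open import Data.Maybe.Properties using (just-injective)
open import Data.List using (List; []; _∷_; _++_; length; map; filter; allFin)
open import Data.List.Properties
  using (length-++; length-map; length-filter; length-tabulate; filter-all; filter-some;
         filter-accept; filter-reject; ++-assoc)
open import Data.List.Membership.Propositional using (_∈_; _∉_)
open import Data.List.Membership.Propositional.Properties using (∈-++⁺ˡ; ∈-++⁺ʳ; ∈-++⁻; ∈-allFin)
open import Data.List.Relation.Unary.Any using (here; there)
import Data.List.Relation.Unary.Any as Any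
open import Data.List.Relation.Unary.All using (All; []; _∷_; lookup)
import Data.List.Relation.Unary.All as All
open import Data.List.Relation.Unary.All.Properties using (++⁻ˡ; all-filter)
import Data.List.Relation.Unary.All.Properties as All
open import Data.List.Relation.Unary.AllPairs using ([]; _∷_)
open import Data.List.Relation.Unary.Unique.Propositional using (Unique)
import Data.List.Relation.Unary.Unique.Propositional.Properties as Unique
open import Data.List.Relation.Binary.Sublist.Propositional using (⊆-refl)
import Data.List.Relation.Binary.Sublist.Propositional.Properties as Sublist
open import Data.Product using (_×_; ∃-syntax; _,_; proj₁; proj₂)
open import Data.Sum using (_⊎_; inj₁; inj₂; [_,_])
import Data.Sum as Sum
open import Data.Unit using (⊤; tt)
open import Function using (_∘_; id)
open import Data.Empty using (⊥; ⊥-elim)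
open import Relation.Nullary using (¬_; Dec; yes; no; contradiction)
open import Relation.Nullary.Decidable using (_⊎-dec_)
open import Relation.Unary using (Decidable)
open import Relation.Binary.PropositionalEquality
  using (_≡_; _≢_; refl; sym; trans; cong; subst; module ≡-Reasoning)
open import Relation.Binary.Definitions using (tri<; tri≈; tri>)

module _ {A : Set} where

  ∈-++-∷-∷⁻ : ∀ (Q : List A) {x y a} → a ∈ Q ++ x ∷ y ∷ [] → a ∈ Q ⊎ a ≡ x ⊎ a ≡ y
  ∈-++-∷-∷⁻ Q a∈ with ∈-++⁻ Q a∈
  ... | inj₁ a∈Q                 = inj₁ a∈Q
  ... | inj₂ (here a≡x)          = inj₂ (inj₁ a≡x)
  ... | inj₂ (there (here a≡y))  = inj₂ (inj₂ a≡y)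

  ∉∧∈⇒≢ : ∀ {xs : List A} {a b} → a ∉ xs → b ∈ xs → a ≢ b
  ∉∧∈⇒≢ a∉ b∈ refl = a∉ b∈

  unique-++⁻ˡ : ∀ (xs : List A) {ys} → Unique (xs ++ ys) → Unique xs
  unique-++⁻ˡ []       _          = []
  unique-++⁻ˡ (x ∷ xs) (x∉ ∷ u) = ++⁻ˡ xs x∉ ∷ unique-++⁻ˡ xs u

  unique-++⇒disjoint : ∀ (xs : List A) {ys a} → Unique (xs ++ ys) → a ∈ xs → a ∉ ys
  unique-++⇒disjoint (x ∷ xs) (x∉ ∷ _) (here refl) a∈ys =
    lookup x∉ (∈-++⁺ʳ xs a∈ys) refl
  unique-++⇒disjoint (x ∷ xs) (_ ∷ u)  (there a∈xs) a∈ys = unique-++⇒disjoint xs u a∈xs a∈ys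

  unique-∷ʳ : ∀ {xs : List A} {a} → Unique xs → a ∉ xs → Unique (xs ++ a ∷ [])
  unique-∷ʳ u a∉ = Unique.++⁺ u ([] ∷ []) λ { (a∈ , here refl) → a∉ a∈ }

  unique-last-two : ∀ (Q : List A) {x y} → Unique (Q ++ x ∷ y ∷ []) → x ∉ Q × y ∉ Q × x ≢ y
  unique-last-two Q u =
      (λ x∈Q → unique-++⇒disjoint Q u x∈Q (here refl))
    , (λ y∈Q → unique-++⇒disjoint Q u y∈Q (there (here refl)))
    , λ x≡y → unique-++⇒disjoint (Q ++ _ ∷ []) (subst Unique (sym (++-assoc Q _ _)) u)
                (∈-++⁺ʳ Q (here refl)) (here x≡y)

  data Consecutive : List A → A → A → Set where
    here  : ∀ {a b xs} → Consecutive (a ∷ b ∷ xs) a b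
    there : ∀ {a b c xs} → Consecutive xs a b → Consecutive (c ∷ xs) a b

  consecutive-++⁺ˡ : ∀ {xs ys a b} → Consecutive xs a b → Consecutive (xs ++ ys) a b
  consecutive-++⁺ˡ here      = here
  consecutive-++⁺ˡ (there c) = there (consecutive-++⁺ˡ c)

  consecutive-last : ∀ (xs : List A) {a b} → Consecutive (xs ++ a ∷ b ∷ []) a b
  consecutive-last []       = here
  consecutive-last (x ∷ xs) = there (consecutive-last xs)

  consecutive⇒∈ : ∀ {xs a b} → Consecutive xs a b → a ∈ xs
  consecutive⇒∈ here      = here refl
  consecutive⇒∈ (there c) = there (consecutive⇒∈ c)

  consecutive-++-∷-∷⁻ : ∀ (Q : List A) {x y a b} → Consecutive (Q ++ x ∷ y ∷ []) a b →
                        Consecutive Q a b ⊎ (a ≡ x × b ≡ y) ⊎ b ≡ x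
  consecutive-++-∷-∷⁻ []          here               = inj₂ (inj₁ (refl , refl))
  consecutive-++-∷-∷⁻ []          (there (there ()))
  consecutive-++-∷-∷⁻ (_ ∷ [])    here               = inj₂ (inj₂ refl)
  consecutive-++-∷-∷⁻ (_ ∷ _ ∷ _) here               = inj₁ here
  consecutive-++-∷-∷⁻ (_ ∷ Q)     (there c)          = Sum.map₁ there (consecutive-++-∷-∷⁻ Q c)

module _ {A B : Set} {P : A → Set} (f : A → B)
         (injectiveOn : ∀ {a b} → P a → P b → f a ≡ f b → a ≡ b) where

  map⁺-injectiveOn : ∀ {xs} → Unique xs → All P xs → Unique (map f xs)
  map⁺-injectiveOn {[]}     []         []         = []
  map⁺-injectiveOn {x ∷ xs} (x∉ ∷ u) (px ∷ pxs) = images-distinct x∉ pxs ∷ map⁺-injectiveOn u pxs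
    where
    images-distinct : ∀ {ys} → All (x ≢_) ys → All P ys → All (f x ≢_) (map f ys)
    images-distinct []            []         = []
    images-distinct (x≢y ∷ x≢ys) (py ∷ pys) = (x≢y ∘ injectiveOn px py) ∷ images-distinct x≢ys pys

module _ {A : Set} {P Q : A → Set} (P? : Decidable P) (Q? : Decidable Q) (P⇒Q : ∀ {a} → P a → Q a) where

  length-filter-mono : ∀ xs → length (filter P? xs) ≤ length (filter Q? xs)
  length-filter-mono xs = Sublist.length-mono-≤ (Sublist.filter⁺ P? Q? (λ { refl → P⇒Q }) (⊆-refl {x = xs}))

  length-filter-< : ∀ xs {z} → z ∈ xs → ¬ P z → Q z → length (filter P? xs) < length (filter Q? xs)
  length-filter-< (x ∷ xs) (here refl) ¬Pz Qz with P? x | Q? x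
  ... | yes Px | _      = contradiction Px ¬Pz
  ... | no _   | yes _  = s≤s (length-filter-mono xs)
  ... | no _   | no ¬Qz = contradiction Qz ¬Qz
  length-filter-< (x ∷ xs) (there z∈) ¬Pz Qz with P? x | Q? x
  ... | yes Px | no ¬Qx = contradiction (P⇒Q Px) ¬Qx
  ... | yes _  | yes _  = s≤s (length-filter-< xs z∈ ¬Pz Qz)
  ... | no _   | yes _  = m≤n⇒m≤1+n (length-filter-< xs z∈ ¬Pz Qz)
  ... | no _   | no _   = length-filter-< xs z∈ ¬Pz Qz

unique-bounded-length : ∀ N {xs} → Unique xs → All (_< N) xs → length xs ≤ N
unique-bounded-length zero    {[]}    _ _ = z≤n
unique-bounded-length zero    {_ ∷ _} _ (() ∷ _)
unique-bounded-length (suc N) {xs} u xs<1+N = begin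
  length xs                         ≤⟨ at-most-one-dropped u xs<1+N ⟩
  suc (length (filter (_<? N) xs))  ≤⟨ s≤s (unique-bounded-length N (Unique.filter⁺ (_<? N) u)
                                                                   (all-filter (_<? N) xs)) ⟩
  suc N                             ∎
  where
  open ≤-Reasoning
  at-most-one-dropped : ∀ {ys} → Unique ys → All (_< suc N) ys →
                        length ys ≤ suc (length (filter (_<? N) ys))
  at-most-one-dropped {[]}     _         _                  = z≤n
  at-most-one-dropped {y ∷ ys} (y∉ ∷ u) (y<1+N ∷ ys<1+N) with y <? N
  ... | yes y<N = subst (λ zs → suc (length ys) ≤ suc (length zs)) (sym (filter-accept (_<? N) y<N))
                    (s≤s (at-most-one-dropped u ys<1+N))
  ... | no y≮N  = subst (λ zs → suc (length ys) ≤ suc (length zs)) (sym (filter-reject (_<? N) y≮N))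
                    (s≤s (≤-reflexive (sym (cong length (filter-all (_<? N) (others-below y∉ ys<1+N))))))
    where
    y≡N : y ≡ N
    y≡N = ≤-antisym (≤-pred y<1+N) (≮⇒≥ y≮N)
    others-below : ∀ {zs} → All (y ≢_) zs → All (_< suc N) zs → All (_< N) zs
    others-below []          []            = []
    others-below (y≢z ∷ y≢zs) (z<1+N ∷ zs<1+N) =
      ≤∧≢⇒< (≤-pred z<1+N) (λ z≡N → y≢z (trans y≡N (sym z≡N))) ∷ others-below y≢zs zs<1+N

1+double-< : ∀ {a b} → a < b → suc (2 * a) < 2 * b
1+double-< {a} {b} a<b = begin-strict
  suc (2 * a)  <⟨ n<1+n _ ⟩
  2 + 2 * a    ≡⟨ sym (*-suc 2 a) ⟩
  2 * suc a    ≤⟨ *-monoʳ-≤ 2 a<b ⟩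
  2 * b        ∎
  where open ≤-Reasoning

module Analysis (G : BipGraph) where
  open BipGraph G using (side; bip)
  open Aug G
  open import Data.List.Membership.DecPropositional {A = V'} _≟_ using (_∈?_)

  colour : V' → Bool
  colour zero          = false
  colour (suc zero)    = true
  colour (suc (suc j)) = not (side j)

  E'⇒colour≢ : ∀ u t → E' u t → colour u ≢ colour t
  E'⇒colour≢ zero           (suc zero)     _ ()
  E'⇒colour≢ (suc zero)     zero           _ ()
  E'⇒colour≢ (suc zero)     (suc (suc j))  e = not-¬ (sym e)
  E'⇒colour≢ (suc (suc i))  (suc zero)     e = not-¬ (sym e) ∘ sym
  E'⇒colour≢ (suc (suc i))  (suc (suc j))  e = bip i j e ∘ not-injective

  parity : ℕ → Bool
  parity zero    = false
  parity (suc k) = not (parity k)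

  parity-+2 : ∀ k → parity (k + 2) ≡ parity k
  parity-+2 zero    = refl
  parity-+2 (suc k) = cong not (parity-+2 k)

  parity-length-∷ʳ : ∀ (xs : List V') a → parity (length (xs ++ a ∷ [])) ≡ not (parity (length xs))
  parity-length-∷ʳ xs a = cong parity (trans (length-++ xs) (+-comm (length xs) 1))

  parity-length-∷-∷ : ∀ (xs : List V') a b → parity (length (xs ++ a ∷ b ∷ [])) ≡ parity (length xs)
  parity-length-∷-∷ xs a b = trans (cong parity (length-++ xs)) (parity-+2 (length xs))

  Alternating : ℕ → List V' → Set
  Alternating k []       = ⊤
  Alternating k (x ∷ xs) = colour x ≡ parity k × Alternating (suc k) xs

  alternating-++⁻ˡ : ∀ k xs {ys} → Alternating k (xs ++ ys) → Alternating k xs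
  alternating-++⁻ˡ k []       _        = tt
  alternating-++⁻ˡ k (x ∷ xs) (c , cs) = c , alternating-++⁻ˡ (suc k) xs cs

  alternating-∷ʳ : ∀ k xs {a} → Alternating k xs → colour a ≡ parity (k + length xs) →
                   Alternating k (xs ++ a ∷ [])
  alternating-∷ʳ k []       _        c = trans c (cong parity (+-identityʳ k)) , tt
  alternating-∷ʳ k (x ∷ xs) (c , cs) c′ =
    c , alternating-∷ʳ (suc k) xs cs (trans c′ (cong parity (+-suc k (length xs))))

  alternating-last : ∀ k xs {a} → Alternating k (xs ++ a ∷ []) → colour a ≡ parity (k + length xs)
  alternating-last k []       (c , _)  = trans c (cong parity (sym (+-identityʳ k)))
  alternating-last k (x ∷ xs) (_ , cs) =
    trans (alternating-last (suc k) xs cs) (cong parity (sym (+-suc k (length xs))))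

  alternating-∷ʳ-≢ : ∀ xs {a b} → Alternating 0 (xs ++ a ∷ []) → colour b ≢ colour a →
                     Alternating 0 ((xs ++ a ∷ []) ++ b ∷ [])
  alternating-∷ʳ-≢ xs {a} {b} alt b≢a = alternating-∷ʳ 0 (xs ++ a ∷ []) alt (begin
    colour b                            ≡⟨ ¬-not b≢a ⟩
    not (colour a)                      ≡⟨ cong not (alternating-last 0 xs alt) ⟩
    not (parity (length xs))            ≡⟨ sym (parity-length-∷ʳ xs a) ⟩
    parity (length (xs ++ a ∷ []))      ∎)
    where open ≡-Reasoning

  alternating-last-two : ∀ Q {x y} → Alternating 0 (Q ++ x ∷ y ∷ []) →
                         colour x ≡ parity (length Q) × colour y ≡ not (parity (length Q))
  alternating-last-two Q {x} alt =
      alternating-last 0 Q (alternating-++⁻ˡ 0 (Q ++ x ∷ []) alt′)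
    , trans (alternating-last 0 (Q ++ x ∷ []) alt′) (parity-length-∷ʳ Q x)
    where alt′ = subst (Alternating 0) (sym (++-assoc Q _ _)) alt

  alternating-extend : ∀ Q {x y z} → Alternating 0 (Q ++ x ∷ y ∷ []) → colour z ≢ colour y →
                       Alternating 0 ((Q ++ x ∷ y ∷ []) ++ z ∷ [])
  alternating-extend Q {x} {y} {z} alt z≢y =
    subst (λ L → Alternating 0 (L ++ z ∷ [])) (++-assoc Q _ _)
      (alternating-∷ʳ-≢ (Q ++ x ∷ []) (subst (Alternating 0) (sym (++-assoc Q _ _)) alt) z≢y)

  record Invariant (σ τ : V' → Maybe V') (P : List V') : Set where
    field
      path-unique      : Unique P
      path-alternating : Alternating 0 P
      σ⇒τ              : ∀ {u t} → σ u ≡ just t → τ t ≡ just u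
      τ⇒σ-off-path     : ∀ {z w} → z ∉ P → τ z ≡ just w → σ w ≡ just z
      σ-τ-disjoint     : ∀ {u t t′} → σ u ≡ just t → τ u ≡ just t′ → ⊥
      σ-successor      : ∀ {u t} → σ u ≡ just t → t ∈ P → Consecutive P t u
      σ-path-closed    : ∀ {u t} → σ u ≡ just t → u ∈ P → t ∈ P
      τ-bichromatic    : ∀ {u t} → τ u ≡ just t → colour t ≢ colour u

  InvariantState : State → Set
  InvariantState (st σ τ _ P) = Invariant σ τ P

  invariant-initial : InvariantState initial
  invariant-initial = record
    { path-unique      = ((λ ()) ∷ []) ∷ [] ∷ []
    ; path-alternating = refl , refl , tt
    ; σ⇒τ              = λ ()
    ; τ⇒σ-off-path     = λ _ ()
    ; σ-τ-disjoint     = λ ()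
    ; σ-successor      = λ ()
    ; σ-path-closed    = λ ()
    ; τ-bichromatic    = λ ()
    }

  upd-≡ : ∀ f a b → upd f a b a ≡ b
  upd-≡ f a b with a ≟ a
  ... | yes _  = refl
  ... | no a≢a = contradiction refl a≢a

  upd-≢ : ∀ f a b {u} → u ≢ a → upd f a b u ≡ f u
  upd-≢ f a b {u} u≢a with u ≟ a
  ... | yes u≡a = contradiction u≡a u≢a
  ... | no _    = refl

  module Deletion (σ τ : V' → Maybe V') (x y : V') where
    σ′ τ′ : V' → Maybe V'
    σ′ = upd (upd σ x (just y)) y nothing
    τ′ = upd (upd τ y (just x)) x nothing

    σ′-x : x ≢ y → σ′ x ≡ just y
    σ′-x x≢y = trans (upd-≢ (upd σ x (just y)) y nothing x≢y) (upd-≡ σ x (just y))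

    σ′-y : σ′ y ≡ nothing
    σ′-y = upd-≡ (upd σ x (just y)) y nothing

    σ′-other : ∀ {u} → u ≢ x → u ≢ y → σ′ u ≡ σ u
    σ′-other u≢x u≢y = trans (upd-≢ (upd σ x (just y)) y nothing u≢y) (upd-≢ σ x (just y) u≢x)

    τ′-x : τ′ x ≡ nothing
    τ′-x = upd-≡ (upd τ y (just x)) x nothing

    τ′-y : x ≢ y → τ′ y ≡ just x
    τ′-y x≢y = trans (upd-≢ (upd τ y (just x)) x nothing (x≢y ∘ sym)) (upd-≡ τ y (just x))

    τ′-other : ∀ {u} → u ≢ x → u ≢ y → τ′ u ≡ τ u
    τ′-other u≢x u≢y = trans (upd-≢ (upd τ y (just x)) x nothing u≢x) (upd-≢ τ y (just x) u≢y)

    σ′-just⁻ : ∀ {u t} → σ′ u ≡ just t → (u ≡ x × t ≡ y) ⊎ (u ≢ x × u ≢ y × σ u ≡ just t)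
    σ′-just⁻ {u} {t} σ′u = cases (u ≟ y) (u ≟ x)
      where
      cases : Dec (u ≡ y) → Dec (u ≡ x) → (u ≡ x × t ≡ y) ⊎ (u ≢ x × u ≢ y × σ u ≡ just t)
      cases (yes refl) _          = contradiction (trans (sym σ′-y) σ′u) λ ()
      cases (no u≢y)   (yes refl) = inj₁ (refl , just-injective (trans (sym σ′u) (σ′-x u≢y)))
      cases (no u≢y)   (no u≢x)   = inj₂ (u≢x , u≢y , trans (sym (σ′-other u≢x u≢y)) σ′u)

    τ′-just⁻ : ∀ {u t} → τ′ u ≡ just t → (u ≡ y × t ≡ x) ⊎ (u ≢ x × u ≢ y × τ u ≡ just t)
    τ′-just⁻ {u} {t} τ′u = cases (u ≟ x) (u ≟ y)
      where
      cases : Dec (u ≡ x) → Dec (u ≡ y) → (u ≡ y × t ≡ x) ⊎ (u ≢ x × u ≢ y × τ u ≡ just t)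
      cases (yes refl) _          = contradiction (trans (sym τ′-x) τ′u) λ ()
      cases (no u≢x)   (yes refl) = inj₁ (refl , just-injective (trans (sym τ′u) (τ′-y (u≢x ∘ sym))))
      cases (no u≢x)   (no u≢y)   = inj₂ (u≢x , u≢y , trans (sym (τ′-other u≢x u≢y)) τ′u)

  invariant-deletion : ∀ {σ τ} Q x y → Invariant σ τ (Q ++ x ∷ y ∷ []) →
                       Invariant (Deletion.σ′ σ τ x y) (Deletion.τ′ σ τ x y) Q
  invariant-deletion {σ} {τ} Q x y I = record
    { path-unique      = unique-++⁻ˡ Q path-unique
    ; path-alternating = alternating-++⁻ˡ 0 Q path-alternating
    ; σ⇒τ              = σ′⇒τ′
    ; τ⇒σ-off-path     = τ′⇒σ′-off-path
    ; σ-τ-disjoint     = λ {u} → σ′-τ′-disjoint {u}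
    ; σ-successor      = σ′-successor
    ; σ-path-closed    = σ′-path-closed
    ; τ-bichromatic    = λ {u} → τ′-bichromatic {u}
    }
    where
    open Invariant I
    open Deletion σ τ x y
    P : List V'
    P = Q ++ x ∷ y ∷ []

    x∉Q : x ∉ Q
    x∉Q = proj₁ (unique-last-two Q path-unique)
    y∉Q : y ∉ Q
    y∉Q = proj₁ (proj₂ (unique-last-two Q path-unique))
    x≢y : x ≢ y
    x≢y = proj₂ (proj₂ (unique-last-two Q path-unique))
    x∈P : x ∈ P
    x∈P = ∈-++⁺ʳ Q (here refl)
    y∈P : y ∈ P
    y∈P = ∈-++⁺ʳ Q (there (here refl))

    σ′⇒τ′ : ∀ {u t} → σ′ u ≡ just t → τ′ t ≡ just u
    σ′⇒τ′ {u} {t} σ′u with σ′-just⁻ {u} σ′u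
    ... | inj₁ (refl , refl)     = τ′-y x≢y
    ... | inj₂ (u≢x , u≢y , σu) = trans (τ′-other t≢x t≢y) (σ⇒τ σu)
      where
      t≢x : t ≢ x
      t≢x refl with consecutive-++-∷-∷⁻ Q (σ-successor σu x∈P)
      ... | inj₁ c                 = x∉Q (consecutive⇒∈ c)
      ... | inj₂ (inj₁ (_ , u≡y)) = u≢y u≡y
      ... | inj₂ (inj₂ u≡x)       = u≢x u≡x
      t≢y : t ≢ y
      t≢y refl with consecutive-++-∷-∷⁻ Q (σ-successor σu y∈P)
      ... | inj₁ c                 = y∉Q (consecutive⇒∈ c)
      ... | inj₂ (inj₁ (y≡x , _)) = x≢y (sym y≡x)
      ... | inj₂ (inj₂ u≡x)       = u≢x u≡x

    τ′⇒σ′-off-path : ∀ {z w} → z ∉ Q → τ′ z ≡ just w → σ′ w ≡ just z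
    τ′⇒σ′-off-path {z} {w} z∉Q τ′z with τ′-just⁻ {z} τ′z
    ... | inj₁ (refl , refl)     = σ′-x x≢y
    ... | inj₂ (z≢x , z≢y , τz) = trans (σ′-other w≢x w≢y) σw
      where
      z∉P : z ∉ P
      z∉P z∈P = [ z∉Q , [ z≢x , z≢y ] ] (∈-++-∷-∷⁻ Q z∈P)
      σw : σ w ≡ just z
      σw = τ⇒σ-off-path z∉P τz
      w≢x : w ≢ x
      w≢x refl = z∉P (σ-path-closed σw x∈P)
      w≢y : w ≢ y
      w≢y refl = z∉P (σ-path-closed σw y∈P)

    σ′-τ′-disjoint : ∀ {u t t′} → σ′ u ≡ just t → τ′ u ≡ just t′ → ⊥
    σ′-τ′-disjoint {u} σ′u τ′u with σ′-just⁻ {u} σ′u | τ′-just⁻ {u} τ′u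
    ... | inj₁ (refl , _)     | inj₁ (x≡y , _)     = x≢y x≡y
    ... | inj₁ (refl , _)     | inj₂ (x≢x , _)     = x≢x refl
    ... | inj₂ (_ , u≢y , _)  | inj₁ (u≡y , _)     = u≢y u≡y
    ... | inj₂ (_ , _ , σu)   | inj₂ (_ , _ , τu)  = σ-τ-disjoint σu τu

    σ′-successor : ∀ {u t} → σ′ u ≡ just t → t ∈ Q → Consecutive Q t u
    σ′-successor {u} σ′u t∈Q with σ′-just⁻ {u} σ′u
    ... | inj₁ (_ , refl)        = contradiction t∈Q y∉Q
    ... | inj₂ (u≢x , _ , σu) with consecutive-++-∷-∷⁻ Q (σ-successor σu (∈-++⁺ˡ t∈Q))
    ...   | inj₁ c                  = c
    ...   | inj₂ (inj₁ (refl , _)) = contradiction t∈Q x∉Q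
    ...   | inj₂ (inj₂ u≡x)        = contradiction u≡x u≢x

    σ′-path-closed : ∀ {u t} → σ′ u ≡ just t → u ∈ Q → t ∈ Q
    σ′-path-closed {u} σ′u u∈Q with σ′-just⁻ {u} σ′u
    ... | inj₁ (refl , _)        = contradiction u∈Q x∉Q
    ... | inj₂ (u≢x , _ , σu) with consecutive-++-∷-∷⁻ Q (σ-successor σu (σ-path-closed σu (∈-++⁺ˡ u∈Q)))
    ...   | inj₁ c                  = consecutive⇒∈ c
    ...   | inj₂ (inj₁ (_ , refl)) = contradiction u∈Q y∉Q
    ...   | inj₂ (inj₂ u≡x)        = contradiction u≡x u≢x

    τ′-bichromatic : ∀ {u t} → τ′ u ≡ just t → colour t ≢ colour u
    τ′-bichromatic {u} τ′u with τ′-just⁻ {u} τ′u | alternating-last-two Q path-alternating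
    ... | inj₁ (refl , refl)  | colour-x , colour-y =
      λ x≡y → not-¬ refl (trans (sym colour-x) (trans x≡y colour-y))
    ... | inj₂ (_ , _ , τu)   | _                   = τ-bichromatic τu

  invariant-introduction-fresh : ∀ {σ τ} Q x y z → InZ σ (Q ++ x ∷ y ∷ []) y z → τ z ≡ nothing →
                                 Invariant σ τ (Q ++ x ∷ y ∷ []) →
                                 Invariant σ τ ((Q ++ x ∷ y ∷ []) ++ z ∷ [])
  invariant-introduction-fresh {σ} Q x y z (z∉P , zy∈E , σz) τz I = record
    { path-unique      = unique-∷ʳ path-unique z∉P
    ; path-alternating = alternating-extend Q path-alternating (E'⇒colour≢ z y zy∈E)
    ; σ⇒τ              = σ⇒τ
    ; τ⇒σ-off-path     = λ z′∉ → τ⇒σ-off-path (z′∉ ∘ ∈-++⁺ˡ)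
    ; σ-τ-disjoint     = σ-τ-disjoint
    ; σ-successor      = successor
    ; σ-path-closed    = path-closed
    ; τ-bichromatic    = τ-bichromatic
    }
    where
    open Invariant I
    P : List V'
    P = Q ++ x ∷ y ∷ []

    successor : ∀ {u t} → σ u ≡ just t → t ∈ P ++ z ∷ [] → Consecutive (P ++ z ∷ []) t u
    successor σu t∈ with ∈-++⁻ P t∈
    ... | inj₁ t∈P         = consecutive-++⁺ˡ (σ-successor σu t∈P)
    ... | inj₂ (here refl) = contradiction (trans (sym τz) (σ⇒τ σu)) λ ()

    path-closed : ∀ {u t} → σ u ≡ just t → u ∈ P ++ z ∷ [] → t ∈ P ++ z ∷ []
    path-closed σu u∈ with ∈-++⁻ P u∈
    ... | inj₁ u∈P         = ∈-++⁺ˡ (σ-path-closed σu u∈P)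
    ... | inj₂ (here refl) = contradiction (trans (sym σz) σu) λ ()

  invariant-introduction-matched : ∀ {σ τ} Q x y z {w} → InZ σ (Q ++ x ∷ y ∷ []) y z → τ z ≡ just w →
                                   Invariant σ τ (Q ++ x ∷ y ∷ []) →
                                   Invariant σ τ (((Q ++ x ∷ y ∷ []) ++ z ∷ []) ++ w ∷ [])
  invariant-introduction-matched {σ} Q x y z {w} (z∉P , zy∈E , σz) τz I = record
    { path-unique      = unique-∷ʳ (unique-∷ʳ path-unique z∉P) w∉P+z
    ; path-alternating = alternating-∷ʳ-≢ P (alternating-extend Q path-alternating (E'⇒colour≢ z y zy∈E))
                                           (τ-bichromatic τz)
    ; σ⇒τ              = σ⇒τ
    ; τ⇒σ-off-path     = λ z′∉ → τ⇒σ-off-path (z′∉ ∘ ∈-++⁺ˡ ∘ ∈-++⁺ˡ)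
    ; σ-τ-disjoint     = σ-τ-disjoint
    ; σ-successor      = successor
    ; σ-path-closed    = path-closed
    ; τ-bichromatic    = τ-bichromatic
    }
    where
    open Invariant I
    P : List V'
    P = Q ++ x ∷ y ∷ []

    σw : σ w ≡ just z
    σw = τ⇒σ-off-path z∉P τz

    w∉P+z : w ∉ P ++ z ∷ []
    w∉P+z w∈ with ∈-++⁻ P w∈
    ... | inj₁ w∈P         = z∉P (σ-path-closed σw w∈P)
    ... | inj₂ (here refl) = contradiction (trans (sym σz) σw) λ ()

    successor : ∀ {u t} → σ u ≡ just t → t ∈ (P ++ z ∷ []) ++ w ∷ [] →
                Consecutive ((P ++ z ∷ []) ++ w ∷ []) t u
    successor σu t∈ with ∈-++⁻ (P ++ z ∷ []) t∈
    ... | inj₂ (here refl) = contradiction (σ⇒τ σu) (σ-τ-disjoint σw)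
    ... | inj₁ t∈P+z with ∈-++⁻ P t∈P+z
    ...   | inj₁ t∈P         = consecutive-++⁺ˡ (consecutive-++⁺ˡ (σ-successor σu t∈P))
    ...   | inj₂ (here refl) with just-injective (trans (sym τz) (σ⇒τ σu))
    ...     | refl = subst (λ L → Consecutive L z w) (sym (++-assoc P _ _)) (consecutive-last P)

    path-closed : ∀ {u t} → σ u ≡ just t → u ∈ (P ++ z ∷ []) ++ w ∷ [] → t ∈ (P ++ z ∷ []) ++ w ∷ []
    path-closed σu u∈ with ∈-++⁻ (P ++ z ∷ []) u∈
    ... | inj₂ (here refl) with just-injective (trans (sym σw) σu)
    ...   | refl = ∈-++⁺ˡ (∈-++⁺ʳ P (here refl))
    path-closed σu u∈ | inj₁ u∈P+z with ∈-++⁻ P u∈P+z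
    ...   | inj₁ u∈P         = ∈-++⁺ˡ (∈-++⁺ˡ (σ-path-closed σu u∈P))
    ...   | inj₂ (here refl) = contradiction (trans (sym σz) σu) λ ()

  invariant-step : ∀ {s l s′} → InvariantState s → Step s l s′ → InvariantState s′
  invariant-step I (deletion Q x y _) = invariant-deletion Q x y I
  invariant-step {st σ τ _ _} I (introduction Q x y z z∈Z) with τ z in τz
  ... | nothing = invariant-introduction-fresh Q x y z z∈Z τz I
  ... | just w  = invariant-introduction-matched Q x y z z∈Z τz I

  Defined : Maybe V' → Set
  Defined m = ∃[ t ] m ≡ just t

  defined? : (m : Maybe V') → Dec (Defined m)
  defined? (just t) = yes (t , refl)
  defined? nothing  = no λ ()

  Touched : State → V' → Set
  Touched (st σ τ _ P) u = Defined (σ u) ⊎ Defined (τ u) ⊎ u ∈ P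

  touched? : ∀ s u → Dec (Touched s u)
  touched? (st σ τ _ P) u = defined? (σ u) ⊎-dec defined? (τ u) ⊎-dec u ∈? P

  potential : State → ℕ
  potential s = length (filter (touched? s) (allFin n))

  potential≤n : ∀ s → potential s ≤ n
  potential≤n s = ≤-trans (length-filter (touched? s) (allFin n)) (≤-reflexive (length-tabulate id))

  potential-mono : ∀ {s s′} → (∀ {u} → Touched s u → Touched s′ u) → potential s ≤ potential s′
  potential-mono {s} {s′} ⊆ = length-filter-mono (touched? s) (touched? s′) ⊆ (allFin n)

  ∈-appendMaybe⁺ : ∀ (L : List V') mw {u} → u ∈ L → u ∈ appendMaybe L mw
  ∈-appendMaybe⁺ L nothing  u∈ = u∈
  ∈-appendMaybe⁺ L (just _) u∈ = ∈-++⁺ˡ u∈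

  touched-deletion : ∀ {σ τ R} Q x y → x ≢ y → ∀ {u} → Touched (st σ τ R (Q ++ x ∷ y ∷ [])) u →
                     Touched (st (Deletion.σ′ σ τ x y) (Deletion.τ′ σ τ x y) R Q) u
  touched-deletion {σ} {τ} {R} Q x y x≢y {u} touched = cases (u ≟ x) (u ≟ y) touched
    where
    open Deletion σ τ x y
    cases : Dec (u ≡ x) → Dec (u ≡ y) → Touched (st σ τ R (Q ++ x ∷ y ∷ [])) u → Touched (st σ′ τ′ R Q) u
    cases (yes refl) _          _                      = inj₁ (y , σ′-x x≢y)
    cases (no _)     (yes refl) _                      = inj₂ (inj₁ (x , τ′-y x≢y))
    cases (no u≢x)   (no u≢y)   (inj₁ (t , σu))        = inj₁ (t , trans (σ′-other u≢x u≢y) σu)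
    cases (no u≢x)   (no u≢y)   (inj₂ (inj₁ (t , τu))) = inj₂ (inj₁ (t , trans (τ′-other u≢x u≢y) τu))
    cases (no u≢x)   (no u≢y)   (inj₂ (inj₂ u∈P))      =
      inj₂ (inj₂ ([ id , [ ⊥-elim ∘ u≢x , ⊥-elim ∘ u≢y ] ] (∈-++-∷-∷⁻ Q u∈P)))

  touched-step : ∀ {s l s′} → InvariantState s → Step s l s′ → ∀ {u} → Touched s u → Touched s′ u
  touched-step {st σ τ R _} I (deletion Q x y _) =
    touched-deletion {σ} {τ} {R} Q x y (proj₂ (proj₂ (unique-last-two Q (Invariant.path-unique I))))
  touched-step {st σ τ _ _} _ (introduction Q x y z _) (inj₁ σu)        = inj₁ σu
  touched-step {st σ τ _ _} _ (introduction Q x y z _) (inj₂ (inj₁ τu)) = inj₂ (inj₁ τu)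
  touched-step {st σ τ _ _} _ (introduction Q x y z _) (inj₂ (inj₂ u∈P)) =
    inj₂ (inj₂ (∈-appendMaybe⁺ _ (τ z) (∈-++⁺ˡ u∈P)))

  potential-step : ∀ {s l s′} → InvariantState s → Step s l s′ → potential s ≤ potential s′
  potential-step {s} {s′ = s′} I step = potential-mono {s} {s′} (touched-step I step)

  potential-fresh-introduction : ∀ {σ τ R} P z → z ∉ P → σ z ≡ nothing → τ z ≡ nothing →
                                 potential (st σ τ R P) < potential (st σ τ (z ∷ R) (P ++ z ∷ []))
  potential-fresh-introduction {σ} {τ} {R} P z z∉P σz τz =
    length-filter-< (touched? (st σ τ R P)) (touched? (st σ τ (z ∷ R) (P ++ z ∷ [])))
      extend (allFin n) (∈-allFin z) untouched (inj₂ (inj₂ (∈-++⁺ʳ P (here refl))))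
    where
    extend : ∀ {u} → Touched (st σ τ R P) u → Touched (st σ τ (z ∷ R) (P ++ z ∷ [])) u
    extend (inj₁ σu)         = inj₁ σu
    extend (inj₂ (inj₁ τu))  = inj₂ (inj₁ τu)
    extend (inj₂ (inj₂ u∈P)) = inj₂ (inj₂ (∈-++⁺ˡ u∈P))
    untouched : ¬ Touched (st σ τ R P) z
    untouched (inj₁ (_ , σz′))        = contradiction (trans (sym σz) σz′) λ ()
    untouched (inj₂ (inj₁ (_ , τz′))) = contradiction (trans (sym τz) τz′) λ ()
    untouched (inj₂ (inj₂ z∈P))       = z∉P z∈P

  -- The configuration right after the deletion of (x, y), b being the parity of |P| then.
  record Retired (x y : V') (b : Bool) (s : State) : Set where
    field
      x∉P      : x ∉ State.P s
      y∉P      : y ∉ State.P s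
      σx       : State.σ s x ≡ just y
      σy       : State.σ s y ≡ nothing
      parity-P : parity (length (State.P s)) ≡ b
      colour-y : colour y ≡ not b

  step-on-path-retires : ∀ {s l s′} v → InvariantState s → Step s l s′ → Contains v l → v ∈ State.P s →
                     ∃[ x ] ∃[ y ] ∃[ b ] (v ≡ x ⊎ v ≡ y) × Retired x y b s′
  step-on-path-retires {st σ τ _ _} v I (deletion Q x y _) v∈xy _
    with unique-last-two Q (Invariant.path-unique I)
  ... | x∉Q , y∉Q , x≢y = x , y , parity (length Q) , v∈xy , record
      { x∉P      = x∉Q
      ; y∉P      = y∉Q
      ; σx       = Deletion.σ′-x σ τ x y x≢y
      ; σy       = Deletion.σ′-y σ τ x y
      ; parity-P = refl
      ; colour-y = proj₂ (alternating-last-two Q (Invariant.path-alternating I))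
      }
  step-on-path-retires v _ (introduction Q x y z (z∉P , _ , _)) (inj₁ refl) v∈P = ⊥-elim (z∉P v∈P)
  step-on-path-retires v I (introduction Q x y z (z∉P , _ , _)) (inj₂ τz) v∈P =
    ⊥-elim (z∉P (Invariant.σ-path-closed I (Invariant.τ⇒σ-off-path I z∉P τz) v∈P))

  introduction-avoids-retired : ∀ {σ τ R x y b} Q x′ y′ z → Invariant σ τ (Q ++ x′ ∷ y′ ∷ []) →
    Retired x y b (st σ τ R (Q ++ x′ ∷ y′ ∷ [])) → InZ σ (Q ++ x′ ∷ y′ ∷ []) y′ z →
    z ≢ x × z ≢ y × τ z ≢ just x × τ z ≢ just y
  introduction-avoids-retired {σ} {τ} {x = x} {y} {b} Q x′ y′ z I ρ (z∉P , zy′∈E , σz) =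
    z≢x , z≢y , (λ τz → z≢y (sym (just-injective (trans (sym σx) (τ⇒σ-off-path z∉P τz))))) ,
    (λ τz → contradiction (trans (sym σy) (τ⇒σ-off-path z∉P τz)) λ ())
    where
    open Invariant I
    open Retired ρ
    z≢x : z ≢ x
    z≢x refl = contradiction (trans (sym σz) σx) λ ()
    z≢y : z ≢ y
    z≢y refl = E'⇒colour≢ z y′ zy′∈E (begin
      colour z                                   ≡⟨ colour-y ⟩
      not b                                      ≡⟨ cong not (sym parity-P) ⟩
      not (parity (length (Q ++ x′ ∷ y′ ∷ [])))  ≡⟨ cong not (parity-length-∷-∷ Q x′ y′) ⟩
      not (parity (length Q))                    ≡⟨ sym (proj₂ (alternating-last-two Q path-alternating)) ⟩
      colour y′                                  ∎)
      where open ≡-Reasoning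

  retired-untouched : ∀ {s l s′ x y b} → InvariantState s → Retired x y b s → Step s l s′ →
                      ¬ Contains x l × ¬ Contains y l
  retired-untouched {x = x} {y} _ ρ (deletion Q x′ y′ _) =
    [ ∉∧∈⇒≢ x∉P (∈-++⁺ʳ Q (here refl)) , ∉∧∈⇒≢ x∉P (∈-++⁺ʳ Q (there (here refl))) ] ,
    [ ∉∧∈⇒≢ y∉P (∈-++⁺ʳ Q (here refl)) , ∉∧∈⇒≢ y∉P (∈-++⁺ʳ Q (there (here refl))) ]
    where open Retired ρ
  retired-untouched I ρ (introduction Q x′ y′ z z∈Z)
    with introduction-avoids-retired Q x′ y′ z I ρ z∈Z
  ... | z≢x , z≢y , τz≢x , τz≢y = [ z≢x ∘ sym , τz≢x ] , [ z≢y ∘ sym , τz≢y ]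

  retired-preserved : ∀ {s l s′ x y b} → InvariantState s → Retired x y b s → Step s l s′ →
                      potential s′ ≤ potential s → Retired x y b s′
  retired-preserved {st σ τ _ _} {x = x} {y} _ ρ (deletion Q x′ y′ _) _ = record
    { x∉P      = x∉P ∘ ∈-++⁺ˡ
    ; y∉P      = y∉P ∘ ∈-++⁺ˡ
    ; σx       = trans (Deletion.σ′-other σ τ x′ y′ (∉∧∈⇒≢ x∉P x′∈P) (∉∧∈⇒≢ x∉P y′∈P)) σx
    ; σy       = trans (Deletion.σ′-other σ τ x′ y′ (∉∧∈⇒≢ y∉P x′∈P) (∉∧∈⇒≢ y∉P y′∈P)) σy
    ; parity-P = trans (sym (parity-length-∷-∷ Q x′ y′)) parity-P
    ; colour-y = colour-y
    }
    where
    open Retired ρ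
    x′∈P : x′ ∈ Q ++ x′ ∷ y′ ∷ []
    x′∈P = ∈-++⁺ʳ Q (here refl)
    y′∈P : y′ ∈ Q ++ x′ ∷ y′ ∷ []
    y′∈P = ∈-++⁺ʳ Q (there (here refl))
  retired-preserved {st σ τ R _} I ρ (introduction Q x′ y′ z z∈Z@(z∉P , _ , σz)) no-growth
    with introduction-avoids-retired Q x′ y′ z I ρ z∈Z | τ z in τz
  ... | _ | nothing = contradiction no-growth (<⇒≱ (potential-fresh-introduction {σ} {τ} {R} _ z z∉P σz τz))
  ... | z≢x , z≢y , τz≢x , τz≢y | just w = record
    { x∉P      = off-path x∉P (z≢x ∘ sym) (≢-partner τz≢x)
    ; y∉P      = off-path y∉P (z≢y ∘ sym) (≢-partner τz≢y)
    ; σx       = σx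
    ; σy       = σy
    ; parity-P = trans (cong parity (cong length (++-assoc P _ _)))
                   (trans (parity-length-∷-∷ P z w) parity-P)
    ; colour-y = colour-y
    }
    where
    open Retired ρ
    P : List V'
    P = Q ++ x′ ∷ y′ ∷ []
    ≢-partner : ∀ {a} → τ z ≢ just a → a ≢ w
    ≢-partner τz≢a refl = τz≢a τz
    off-path : ∀ {a} → a ∉ P → a ≢ z → a ≢ w → a ∉ (P ++ z ∷ []) ++ w ∷ []
    off-path a∉P a≢z a≢w a∈ with ∈-++⁻ (P ++ z ∷ []) a∈
    ... | inj₂ (here a≡w) = a≢w a≡w
    ... | inj₁ a∈P+z with ∈-++⁻ P a∈P+z
    ...   | inj₁ a∈P        = a∉P a∈P
    ...   | inj₂ (here a≡z) = a≢z a≡z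

  ∈-appendMaybe-just : ∀ (L : List V') {mw v} → mw ≡ just v → v ∈ appendMaybe L mw
  ∈-appendMaybe-just L refl = ∈-++⁺ʳ L (here refl)

  leaving-path⇒contains : ∀ {s l s′} v → Step s l s′ → v ∈ State.P s → v ∉ State.P s′ → Contains v l
  leaving-path⇒contains v (deletion Q x y _) v∈P v∉Q =
    [ ⊥-elim ∘ v∉Q , id ] (∈-++-∷-∷⁻ Q v∈P)
  leaving-path⇒contains {st σ τ _ _} v (introduction Q x y z _) v∈P v∉P′ =
    ⊥-elim (v∉P′ (∈-appendMaybe⁺ _ (τ z) (∈-++⁺ˡ v∈P)))

  contains⇒joins-path : ∀ {s l s′} v → Step s l s′ → v ∉ State.P s → Contains v l → v ∈ State.P s′
  contains⇒joins-path v (deletion Q x y _) v∉P (inj₁ refl) = ⊥-elim (v∉P (∈-++⁺ʳ Q (here refl)))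
  contains⇒joins-path v (deletion Q x y _) v∉P (inj₂ refl) = ⊥-elim (v∉P (∈-++⁺ʳ Q (there (here refl))))
  contains⇒joins-path {st σ τ _ _} v (introduction Q x y z _) _ (inj₁ refl) =
    ∈-appendMaybe⁺ _ (τ z) (∈-++⁺ʳ _ (here refl))
  contains⇒joins-path {st σ τ _ _} v (introduction Q x y z _) _ (inj₂ τz≡v) =
    ∈-appendMaybe-just _ τz≡v

  module Run (ex : Execution) (v : V') where
    open Execution ex
    open ≤-Reasoning hiding (start)

    path : ℕ → List V'
    path t = State.P (state t)

    pot : ℕ → ℕ
    pot t = potential (state t)

    invariant : ∀ t → InvariantState (state t)
    invariant zero    = subst InvariantState (sym start) invariant-initial
    invariant (suc t) with run t
    ... | inj₁ (_ , step)   = invariant-step (invariant t) step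
    ... | inj₂ (_ , frozen) = subst InvariantState (sym frozen) (invariant t)

    step-at : ∀ t → Active (state t) → Step (state t) (label t) (state (suc t))
    step-at t active with run t
    ... | inj₁ (_ , step)     = step
    ... | inj₂ (inactive , _) = contradiction active inactive

    pot-suc : ∀ t → pot t ≤ pot (suc t)
    pot-suc t with run t
    ... | inj₁ (_ , step)   = potential-step (invariant t) step
    ... | inj₂ (_ , frozen) = ≤-reflexive (cong potential (sym frozen))

    pot-mono : ∀ {a b} → a ≤′ b → pot a ≤ pot b
    pot-mono ≤′-refl        = ≤-refl
    pot-mono (≤′-step a≤′b) = ≤-trans (pot-mono a≤′b) (pot-suc _)

    retired-persists : ∀ {x y b a j} → Retired x y b (state a) → a ≤′ j → pot j ≤ pot a →
                       Retired x y b (state j)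
    retired-persists ρ ≤′-refl _ = ρ
    retired-persists ρ (≤′-step {j} a≤′j) no-growth
      with run j | retired-persists ρ a≤′j (≤-trans (pot-suc j) no-growth)
    ... | inj₁ (_ , step)   | ρj = retired-preserved (invariant j) ρj step (≤-trans no-growth (pot-mono a≤′j))
    ... | inj₂ (_ , frozen) | ρj = subst (Retired _ _ _) (sym frozen) ρj

    revisit-raises-potential : ∀ {d j} → InS ex v d → v ∈ path d → d < j → InS ex v j → pot d < pot j
    revisit-raises-potential {d} {j} (active-d , d∋v) v∈P d<j (active-j , j∋v) with pot d <? pot j
    ... | yes grown = grown
    ... | no ¬grown with step-on-path-retires v (invariant d) (step-at d active-d) d∋v v∈P
    ...   | x , y , b , v≡x⊎v≡y , ρ =
      ⊥-elim ([ (λ { refl → proj₁ untouched j∋v }) , (λ { refl → proj₂ untouched j∋v }) ] v≡x⊎v≡y)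
      where
      untouched : ¬ Contains x (label j) × ¬ Contains y (label j)
      untouched = retired-untouched (invariant j)
        (retired-persists ρ (≤⇒≤′ d<j) (≤-trans (≮⇒≥ ¬grown) (pot-suc d))) (step-at j active-j)

    leaves-path : ∀ {a j} → v ∈ path a → a ≤′ j → v ∉ path j →
                  ∃[ d ] a ≤′ d × d < j × InS ex v d × v ∈ path d
    leaves-path v∈ ≤′-refl v∉ = contradiction v∈ v∉
    leaves-path v∈ (≤′-step {j} a≤′j) v∉ with v ∈? path j | run j
    ... | yes v∈j | inj₁ (active , step) =
      j , a≤′j , ≤-refl , (active , leaving-path⇒contains v step v∈j v∉) , v∈j
    ... | yes v∈j | inj₂ (_ , frozen) = contradiction (subst (λ s → v ∈ State.P s) (sym frozen) v∈j) v∉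
    ... | no v∉j  | _ with leaves-path v∈ a≤′j v∉j
    ...   | d , a≤′d , d<j , d∈S , v∈d = d , a≤′d , m<n⇒m<1+n d<j , d∈S , v∈d

    rank : ℕ → ℕ
    rank t with v ∈? path t
    ... | yes _ = suc (2 * pot t)
    ... | no _  = 2 * pot t

    rank-on : ∀ {t} → v ∈ path t → rank t ≡ suc (2 * pot t)
    rank-on {t} v∈ with v ∈? path t
    ... | yes _  = refl
    ... | no v∉ = contradiction v∈ v∉

    rank-off : ∀ {t} → v ∉ path t → rank t ≡ 2 * pot t
    rank-off {t} v∉ with v ∈? path t
    ... | yes v∈ = contradiction v∈ v∉
    ... | no _   = refl

    double≤rank : ∀ t → 2 * pot t ≤ rank t
    double≤rank t with v ∈? path t
    ... | yes _ = n≤1+n _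
    ... | no _  = ≤-refl

    rank-< : ∀ {i j} → InS ex v i → InS ex v j → i < j → rank i < rank j
    rank-< {i} {j} i∈S j∈S i<j = by-cases (v ∈? path i) (v ∈? path j)
      where
      by-cases : Dec (v ∈ path i) → Dec (v ∈ path j) → rank i < rank j
      by-cases (yes v∈i) _ = begin-strict
        rank i          ≡⟨ rank-on v∈i ⟩
        suc (2 * pot i) <⟨ 1+double-< (revisit-raises-potential i∈S v∈i i<j j∈S) ⟩
        2 * pot j       ≤⟨ double≤rank j ⟩
        rank j          ∎
      by-cases (no v∉i) (yes v∈j) = begin-strict
        rank i          ≡⟨ rank-off v∉i ⟩
        2 * pot i       ≤⟨ *-monoʳ-≤ 2 (pot-mono (≤⇒≤′ (<⇒≤ i<j))) ⟩
        2 * pot j       <⟨ n<1+n _ ⟩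
        suc (2 * pot j) ≡⟨ sym (rank-on v∈j) ⟩
        rank j          ∎
      by-cases (no v∉i) (no v∉j)
        with leaves-path (contains⇒joins-path v (step-at i (proj₁ i∈S)) v∉i (proj₂ i∈S)) (≤⇒≤′ i<j) v∉j
      ... | d , 1+i≤′d , d<j , d∈S , v∈d = begin-strict
        rank i          ≡⟨ rank-off v∉i ⟩
        2 * pot i       ≤⟨ *-monoʳ-≤ 2 (pot-mono (≤′-trans (≤′-step ≤′-refl) 1+i≤′d)) ⟩
        2 * pot d       <⟨ *-monoʳ-< 2 (revisit-raises-potential d∈S v∈d d<j j∈S) ⟩
        2 * pot j       ≡⟨ sym (rank-off v∉j) ⟩
        rank j          ∎

    rank≤1+double : ∀ t → rank t ≤ suc (2 * pot t)
    rank≤1+double t with v ∈? path t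
    ... | yes _ = ≤-refl
    ... | no _  = n≤1+n _

    2≤rank : ∀ {t} → InS ex v t → 2 ≤ rank t
    2≤rank {t} (active , _) = ≤-trans (*-monoʳ-≤ 2 0<pot) (double≤rank t)
      where
      on-path : ∀ (L : List V') → 2 ≤ length L → ∃[ u ] u ∈ L
      on-path (u ∷ _) _ = u , here refl
      0<pot : 0 < pot t
      0<pot with on-path (path t) active
      ... | u , u∈P = filter-some (touched? (state t)) (Any.map (λ { refl → inj₂ (inj₂ u∈P) }) (∈-allFin u))

    index : ℕ → ℕ
    index t = rank t ∸ 2

    index-< : ∀ {t} → InS ex v t → index t < 2 * n
    index-< {t} t∈S = ∸-monoˡ-< (s≤s (begin
      rank t          ≤⟨ rank≤1+double t ⟩
      suc (2 * pot t) ≤⟨ s≤s (*-monoʳ-≤ 2 (potential≤n (state t))) ⟩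
      suc (2 * n)     ∎)) (2≤rank t∈S)

    index-injective : ∀ {i j} → InS ex v i → InS ex v j → index i ≡ index j → i ≡ j
    index-injective {i} {j} i∈S j∈S eq with <-cmp i j
    ... | tri< i<j _ _ = contradiction eq (<⇒≢ (∸-monoˡ-< (rank-< i∈S j∈S i<j) (2≤rank i∈S)))
    ... | tri≈ _ i≡j _ = i≡j
    ... | tri> _ _ j<i = contradiction (sym eq) (<⇒≢ (∸-monoˡ-< (rank-< j∈S i∈S j<i) (2≤rank j∈S)))

lemma2 : (G : BipGraph) → (ex : Aug.Execution G) → (v : Aug.V' G) →
    (is : List ℕ) → Unique is → All (Aug.InS G ex v) is →
    length is ≤ 2 * Aug.n G
lemma2 G ex v is distinct is⊆S = begin
  length is             ≡⟨ sym (length-map index is) ⟩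
  length (map index is) ≤⟨ unique-bounded-length (2 * Aug.n G)
                             (map⁺-injectiveOn index index-injective distinct is⊆S)
                             (All.map⁺ (All.map index-< is⊆S)) ⟩
  2 * Aug.n G           ∎
  where
  open Analysis.Run G ex v
  open ≤-Reasoning
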